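{- Let $X$ be a set and $R$ a reflexive binary relation on $X$. For $x\in X$ let $[x]^R=\{a\in X: Rxa\}$ and $\langle x\rangle=\bigcap\{[b]^R : b\in X,\ x\in [b]^R\}$. Then: (1) for all $a,b\in X$, if $a\in\langle b\rangle$ then $\langle a\rangle\subseteq\langle b\rangle$; (2) if $\tau$ is the binary relation on $X$ defined by $\tau ab$ if and only if $a\in\langle b\rangle$, then $\tau$ is reflexive and transitive, and it is weakly antisymmetric in the sense that $\tau ab$ and $\tau ba$ imply $\langle a\rangle=\langle b\rangle$. -}

module Defs where

open import Level using (Level; _⊔_)
open import Relation.Unary using (Pred; _⊆_; _∈_)
open import Relation.Binary.Core using (Rel)
open import Relation.Binary.Definitions using (Reflexive; Transitive)
open import Data.Product using (_×_)

upset : ∀ {a ℓ} {X : Set a} → Rel X ℓ → X → Pred X ℓ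
upset R x a = R x a

cl : ∀ {a ℓ} {X : Set a} → Rel X ℓ → X → Pred X (a ⊔ ℓ)
cl {X = X} R x a = ∀ (b : X) → x ∈ upset R b → a ∈ upset R b

τ : ∀ {a ℓ} {X : Set a} → Rel X ℓ → Rel X (a ⊔ ℓ)
τ R a b = a ∈ cl R b

_≐_ : ∀ {a ℓ} {X : Set a} → Pred X ℓ → Pred X ℓ → Set (a ⊔ ℓ)
P ≐ Q = (P ⊆ Q) × (Q ⊆ P)

module Submission where

open import Defs
open import Relation.Unary using (_⊆_; _∈_)
open import Relation.Binary.Core using (Rel)
open import Relation.Binary.Definitions using (Reflexive; Transitive)
open import Data.Product using (_×_; _,_)

-- ⟨b⟩ is an intersection of R-upsets each containing b, so any such upset
-- containing a also contains everything in ⟨a⟩.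

module _ {a ℓ} {X : Set a} (R : Rel X ℓ) where

  cl-⊆ : ∀ {x y} → x ∈ cl R y → cl R x ⊆ cl R y
  cl-⊆ x∈⟨y⟩ z∈⟨x⟩ b y∈[b] = z∈⟨x⟩ b (x∈⟨y⟩ b y∈[b])

  τ-refl : Reflexive (τ R)
  τ-refl b x∈[b] = x∈[b]

  τ-trans : Transitive (τ R)
  τ-trans x∈⟨y⟩ y∈⟨z⟩ = cl-⊆ y∈⟨z⟩ x∈⟨y⟩

  τ-antisym-cl : ∀ {x y} → τ R x y → τ R y x → cl R x ≐ cl R y
  τ-antisym-cl x∈⟨y⟩ y∈⟨x⟩ = cl-⊆ x∈⟨y⟩ , cl-⊆ y∈⟨x⟩

mainTheorem1 : ∀ {a ℓ} {X : Set a} (R : Rel X ℓ) → Reflexive R →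
    (∀ (x y : X) → x ∈ cl R y → cl R x ⊆ cl R y)
    × (Reflexive (τ R) × Transitive (τ R) × (∀ {x y : X} → τ R x y → τ R y x → cl R x ≐ cl R y))
mainTheorem1 R _ =
  (λ _ _ → cl-⊆ R) , τ-refl R , τ-trans R , τ-antisym-cl R
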